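{- Let $n\ge2$ and let $F_{2n+1}=\mathrm{Wd}(3,n)$ be the friendship graph. If $n>\lfloor\tfrac12\,\overline{(\overline{n}+1)}\rfloor$, then $t(F_{2n+1})=t(1,n)+3$. Otherwise, $t(1,n)+2\le t(F_{2n+1})\le t(1,n)+3$.
   Context: The friendship graph $F_{2n+1}=\mathrm{Wd}(3,n)$ is obtained by taking $n$ triangles and identifying one vertex from each triangle into a single shared vertex; it has $2n+1$ vertices. For an integer $m\ge2$, $\overline{m}=\min\{\binom{x}{\lfloor x/2\rfloor}: x\in\mathbb N,\ \binom{x}{\lfloor x/2\rfloor}\ge m\}$. For a finite simple graph $G$, a $G$-CFF$(t,|V(G)|)$ is a family of subsets $B_v\subseteq[1,t]=\{1,\dots,t\}$, one for each vertex $v$, such that for every edge $\{a,b\}$: (i) $B_a\not\subseteq B_b$ and $B_b\not\subseteq B_a$, and (ii) for every vertex $w\notin\{a,b\}$, $B_w\not\subseteq B_a\cup B_b$; $t(G)$ is the minimum $t$ for which one exists. $t(1,n)$ is the minimum $t$ such that there exist $n$ subsets of $[1,t]$ none contained in another; equivalently $t(1,n)=\min\{t:\binom{t}{\lfloor t/2\rfloor}\ge n\}$. -}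

module Defs where

open import Level using (0ℓ)
open import Data.Nat using (ℕ; _≤_; _+_)
open import Data.Nat.DivMod using (_/_)
open import Data.Nat.Combinatorics using (_C_)
open import Data.Fin using (Fin)
open import Data.Fin.Subset using (Subset; _⊆_; _∪_)
open import Data.Bool using (Bool)
open import Data.Unit using (⊤; tt)
open import Data.Sum using (_⊎_; inj₁; inj₂)
open import Data.Product using (Σ; _×_; ∃-syntax)
open import Data.Empty using (⊥)
open import Relation.Nullary using (¬_)
open import Relation.Binary.PropositionalEquality using (_≡_; _≢_)

IsMinimum : (ℕ → Set) → ℕ → Set
IsMinimum P v = P v × (∀ u → P u → v ≤ u)

centralBinom : ℕ → ℕ
centralBinom x = x C (x / 2)

-- the set { C(x,⌊x/2⌋) : x ∈ ℕ, C(x,⌊x/2⌋) ≥ m };  m̄ is its minimum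
BarSet : ℕ → ℕ → Set
BarSet m u = ∃[ x ] (u ≡ centralBinom x × m ≤ u)

record Graph : Set₁ where
  field
    V   : Set
    Adj : V → V → Set

open Graph public

IsGCFF : (G : Graph) (t : ℕ) → (V G → Subset t) → Set
IsGCFF G t B =
  ∀ a b → Adj G a b →
    (¬ (B a ⊆ B b)) × (¬ (B b ⊆ B a)) ×
    (∀ w → w ≢ a → w ≢ b → ¬ (B w ⊆ (B a ∪ B b)))

HasGCFF : Graph → ℕ → Set
HasGCFF G t = Σ (V G → Subset t) (IsGCFF G t)

HasAntichain : ℕ → ℕ → Set
HasAntichain n t =
  Σ (Fin n → Subset t) λ A → ∀ i j → i ≢ j → ¬ (A i ⊆ A j)

-- friendship graph Wd(3,n): centre inj₁ tt, and triangle i has the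
-- two further vertices inj₂ (i , false), inj₂ (i , true)
FVert : ℕ → Set
FVert n = ⊤ ⊎ (Fin n × Bool)

FAdj : (n : ℕ) → FVert n → FVert n → Set
FAdj n (inj₁ _) (inj₁ _) = ⊥
FAdj n (inj₁ _) (inj₂ _) = ⊤
FAdj n (inj₂ _) (inj₁ _) = ⊤
FAdj n (inj₂ (i Data.Product., b)) (inj₂ (j Data.Product., c)) = (i ≡ j) × (b ≢ c)

friendship : ℕ → Graph
friendship n = record { V = FVert n ; Adj = FAdj n }

-- By Sperner's theorem (Lubell's inequality, with the middle layer for sharpness),
-- m pairwise non-nested subsets of [t] exist iff m ≤ C(t, ⌊t/2⌋).
--
-- Upper bound: from an antichain A₁, …, Aₙ in [t], give the centre the set {t+3} and
-- the two leaves of triangle i the sets Aᵢ ∪ {t+1} and Aᵢ ∪ {t+2}.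
--
-- Lower bound: pick x in the centre's set B_c. For distinct leaves u, v the CFF
-- condition on the edge c v gives B_u ⊈ B_c ∪ B_v, so deleting x leaves 2n pairwise
-- non-nested leaf sets in [t(F) − 1]; those agreeing in their first point include n
-- sets in [t(F) − 2], whence t(1, n) + 2 ≤ t(F). Let N = \overline{(\overline n + 1)}:
-- it is a central binomial coefficient above \overline n ≥ C(t(1, n), ·), hence at
-- least C(t(1, n) + 1, ·). So if t(F) ≤ t(1, n) + 2, then 2n ≤ C(t(F) − 1, ·) ≤ N,
-- that is, n ≤ ⌊N/2⌋.
module Submission where

open import Defs
open import Data.Bool using (Bool; false; true; if_then_else_)
import Data.Bool as Bool
open import Data.Bool.Properties using (¬-not)
open import Data.Empty using (⊥-elim)
open import Data.Fin as Fin using (Fin; zero; suc; inject≤)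
open import Data.Fin.Properties using (inject≤-injective; join-splitAt)
open import Data.Fin.Subset
  using (Subset; Side; inside; outside; ⊥; ⁅_⁆; _∪_; _∈_; _⊆_; _⊈_; ∣_∣; Nonempty; Empty)
open import Data.Fin.Subset.Properties
  using (_∈?_; nonempty?; Empty-unique; drop-∷-⊆; s⊆s; ⊆-trans; ∣p∣≤n; ∣⊥∣≡0; p⊆q⇒∣p∣≤∣q∣;
         x∈⁅x⁆; x∈⁅y⁆⇒x≡y; q⊆p∪q; x∈p∪q⁺; x∈p∪q⁻; ∪-comm; ∪-idem; ∪-identityˡ)
open import Data.List using (List; []; _∷_; [_]; _++_; map; length; tabulate; lookup)
open import Data.List.Membership.Propositional.Properties using (∈-lookup)
open import Data.List.Properties using (map-cong-local; length-tabulate; length-++; length-map)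
open import Data.List.Relation.Unary.All as All using (All; []; _∷_; all?)
import Data.List.Relation.Unary.All.Properties as Allₚ
open import Data.List.Relation.Unary.AllPairs as AllPairs using (AllPairs; []; _∷_)
import Data.List.Relation.Unary.AllPairs.Properties as AllPairsₚ
open import Data.List.Relation.Unary.Any using (Any; here; there)
open import Data.Nat
  using (ℕ; zero; suc; pred; _≤_; _<_; _+_; _*_; _∸_; _!; z≤n; s≤s; s≤s⁻¹; NonZero; _≤′_; ≤′-reflexive; ≤′-step)
open import Data.Nat.Combinatorics using (_C_; k![n∸k]!∣n!; nCk+nC[k+1]≡[n+1]C[k+1])
open import Data.Nat.Combinatorics.Specification using (nCk≡n!/k![n-k]!)
open import Data.Nat.DivMod using (_/_; _%_; m≡m%n+[m/n]*n; m%n<n; m/n≤m; m/n*n≡m; m*n/n≡m; /-monoˡ-≤)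
open import Data.Nat.ListAction using (sum)
open import Data.Nat.Properties
open import Data.Product using (_×_; _,_; proj₁; proj₂; swap; uncurry)
open import Data.Sum as Sum using (_⊎_; inj₁; inj₂; [_,_]′)
open import Data.Sum.Properties using (inj₂-injective)
open import Data.Unit using (tt)
open import Data.Vec using ([]; _∷_; removeAt; here; there) renaming (_++_ to _++ᵛ_)
open import Data.Vec.Properties using ([]=⇒lookup; zipWith-++)
open import Function using (_∘_)
open import Algebra.Properties.CommutativeSemigroup *-commutativeSemigroup using (x∙yz≈y∙xz)
open import Relation.Nullary using (¬_; does; yes; no; contradiction)
open import Relation.Binary.PropositionalEquality
  using (_≡_; _≢_; refl; sym; trans; cong; cong₂; subst; subst₂; module ≡-Reasoning)
open import Algebra.Properties.CommutativeMonoid.Sum +-0-commutativeMonoid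
  using (sum-syntax; sum-cong-≗; ∑-distrib-+; sum-replicate-zero)

private
  variable
    t : ℕ

-- Lubell's inequality and Sperner's theorem

∑-mono-≤ : ∀ {n} {f g : Fin n → ℕ} → (∀ i → f i ≤ g i) → ∑[ i < n ] f i ≤ ∑[ i < n ] g i
∑-mono-≤ {zero}  _   = z≤n
∑-mono-≤ {suc n} f≤g = +-mono-≤ (f≤g zero) (∑-mono-≤ (f≤g ∘ suc))

∑-const : ∀ n c → ∑[ i < n ] c ≡ n * c
∑-const zero    c = refl
∑-const (suc n) c = cong (c +_) (∑-const n c)

sum-map-∑ : ∀ {A : Set} n (f : Fin n → A → ℕ) (xs : List A) →
            sum (map (λ x → ∑[ i < n ] f i x) xs) ≡ ∑[ i < n ] sum (map (f i) xs)
sum-map-∑ n f []       = sym (sum-replicate-zero n)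
sum-map-∑ n f (x ∷ xs) = trans (cong (∑[ i < n ] f i x +_) (sum-map-∑ n f xs))
                               (sym (∑-distrib-+ (λ i → f i x) _))

∑-indicator : ∀ (A : Subset t) c → ∑[ i < t ] (if does (i ∈? A) then c else 0) ≡ ∣ A ∣ * c
∑-indicator []            c = refl
∑-indicator (inside ∷ A)  c = cong (c +_) (∑-indicator A c)
∑-indicator (outside ∷ A) c = ∑-indicator A c

∷-⊆ : ∀ {x y : Side} {p q : Subset t} → (x ≡ inside → y ≡ inside) → p ⊆ q → x ∷ p ⊆ y ∷ q
∷-⊆ x⇒y _   here        rewrite x⇒y refl = here
∷-⊆ _   p⊆q (there x∈p) = there (p⊆q x∈p)

⊆-head : ∀ {x y : Side} {p q : Subset t} → x ∷ p ⊆ y ∷ q → x ≡ inside → y ≡ inside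
⊆-head xp⊆yq refl = []=⇒lookup (xp⊆yq here)

removeAt-⊆⁻ : ∀ {A B : Subset (suc t)} i → i ∈ B → removeAt A i ⊆ removeAt B i → A ⊆ B
removeAt-⊆⁻ {A = _ ∷ _} zero here A⊆B = ∷-⊆ (λ _ → refl) A⊆B
removeAt-⊆⁻ {suc t} {_ ∷ _ ∷ _} {_ ∷ _ ∷ _} (suc i) (there i∈B) A⊆B =
  ∷-⊆ (⊆-head A⊆B) (removeAt-⊆⁻ i i∈B (drop-∷-⊆ A⊆B))

removeAt-⊆ : ∀ {A B : Subset (suc t)} i → A ⊆ B → removeAt A i ⊆ removeAt B i
removeAt-⊆ {A = _ ∷ _} {_ ∷ _} zero A⊆B = drop-∷-⊆ A⊆B
removeAt-⊆ {suc t} {_ ∷ _ ∷ _} {_ ∷ _ ∷ _} (suc i) A⊆B =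
  ∷-⊆ (⊆-head A⊆B) (removeAt-⊆ i (drop-∷-⊆ A⊆B))

∣removeAt∣ : ∀ {A : Subset (suc t)} {i} → i ∈ A → ∣ A ∣ ≡ suc ∣ removeAt A i ∣
∣removeAt∣ {A = inside ∷ _} here = refl
∣removeAt∣ {suc t} {inside  ∷ _ ∷ _} (there i∈A) = cong suc (∣removeAt∣ i∈A)
∣removeAt∣ {suc t} {outside ∷ _ ∷ _} (there i∈A) = ∣removeAt∣ i∈A

Incomparable : Subset t → Subset t → Set
Incomparable A B = A ⊈ B × B ⊈ A

Empty⇒⊆ : ∀ {A B : Subset t} → Empty A → A ⊆ B
Empty⇒⊆ A-empty x∈A = contradiction (_ , x∈A) A-empty

-- the number of maximal chains ∅ ⊂ {x₁} ⊂ … ⊂ [t] passing through A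
weight : ∀ t → Subset t → ℕ
weight t A = ∣ A ∣ ! * (t ∸ ∣ A ∣) !

weight-Empty : ∀ {A : Subset t} → Empty A → weight t A ≡ t !
weight-Empty {t} A-empty rewrite Empty-unique A-empty | ∣⊥∣≡0 t = +-identityʳ (t !)

weightVia : Fin (suc t) → Subset (suc t) → ℕ
weightVia {t} i A = if does (i ∈? A) then weight t (removeAt A i) else 0

-- A maximal chain through a nonempty A enters A by adding exactly one point i ∈ A.
weight-suc : ∀ (A : Subset (suc t)) → Nonempty A → weight (suc t) A ≡ ∑[ i < suc t ] weightVia i A
weight-suc {t} A (x , x∈A) = begin
  weight (suc t) A                   ≡⟨ cong (λ a → a ! * (suc t ∸ a) !) (∣removeAt∣ x∈A) ⟩
  suc k ! * (t ∸ k) !                ≡⟨ *-assoc (suc k) (k !) ((t ∸ k) !) ⟩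
  suc k * weight t (removeAt A x)    ≡⟨ cong (_* weight t (removeAt A x)) (∣removeAt∣ x∈A) ⟨
  ∣ A ∣ * weight t (removeAt A x)    ≡⟨ ∑-indicator A _ ⟨
  ∑[ i < suc t ] (if does (i ∈? A) then weight t (removeAt A x) else 0)
    ≡⟨ sum-cong-≗ same-weight ⟩
  ∑[ i < suc t ] weightVia i A ∎
  where
  open ≡-Reasoning
  k : ℕ
  k = ∣ removeAt A x ∣
  same-weight : ∀ i → (if does (i ∈? A) then weight t (removeAt A x) else 0) ≡ weightVia i A
  same-weight i with i ∈? A
  ... | yes i∈A =
    cong (λ a → a ! * (t ∸ a) !) (suc-injective (trans (sym (∣removeAt∣ x∈A)) (∣removeAt∣ i∈A)))
  ... | no  _   = refl

link : Fin (suc t) → List (Subset (suc t)) → List (Subset t)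
link i []      = []
link i (A ∷ L) with i ∈? A
... | yes _ = removeAt A i ∷ link i L
... | no  _ = link i L

sum-weight-link : ∀ i (L : List (Subset (suc t))) →
                  sum (map (weight t) (link i L)) ≡ sum (map (weightVia i) L)
sum-weight-link i []      = refl
sum-weight-link i (A ∷ L) with i ∈? A
... | yes _ = cong (weight _ (removeAt A i) +_) (sum-weight-link i L)
... | no  _ = sum-weight-link i L

link-All : ∀ {i} {A : Subset (suc t)} → i ∈ A → ∀ {L} →
           All (Incomparable A) L → All (Incomparable (removeAt A i)) (link i L)
link-All         i∈A []                = []
link-All {i = i} i∈A {B ∷ L} (A∥B ∷ A∥L) with i ∈? B
... | yes i∈B = (proj₁ A∥B ∘ removeAt-⊆⁻ i i∈B , proj₂ A∥B ∘ removeAt-⊆⁻ i i∈A) ∷ link-All i∈A A∥L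
... | no  _   = link-All i∈A A∥L

link-antichain : ∀ i {L : List (Subset (suc t))} →
                 AllPairs Incomparable L → AllPairs Incomparable (link i L)
link-antichain i []                 = []
link-antichain i {A ∷ L} (A∥L ∷ anti) with i ∈? A
... | yes i∈A = link-All i∈A A∥L ∷ link-antichain i anti
... | no  _   = link-antichain i anti

sum-weight-Empty : ∀ {L : List (Subset t)} → AllPairs Incomparable L → Any Empty L →
                   sum (map (weight t) L) ≡ t !
sum-weight-Empty {L = A ∷ []}    _               (here A-empty) = trans (+-identityʳ _) (weight-Empty A-empty)
sum-weight-Empty {L = A ∷ B ∷ _} ((A∥B ∷ _) ∷ _) (here A-empty) = ⊥-elim (proj₁ A∥B (Empty⇒⊆ A-empty))
sum-weight-Empty                 (A∥L ∷ _)       (there E∈L)    =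
  ⊥-elim (All.lookupWith (λ A∥E E-empty → proj₂ A∥E (Empty⇒⊆ E-empty)) A∥L E∈L)

-- Lubell's inequality: each of the t ! maximal chains meets an antichain at most once.
lubell : ∀ t (L : List (Subset t)) → AllPairs Incomparable L → sum (map (weight t) L) ≤ t !
lubell t L anti with all? nonempty? L
... | no ¬all-nonempty = ≤-reflexive (sum-weight-Empty anti (Allₚ.¬All⇒Any¬ nonempty? L ¬all-nonempty))
lubell zero    []       _    | yes _ = z≤n
lubell zero    ([] ∷ _) _    | yes ((_ , ()) ∷ _)
lubell (suc t) L        anti | yes all-nonempty = begin
  sum (map (weight (suc t)) L)
    ≡⟨ cong sum (map-cong-local (All.map (weight-suc _) all-nonempty)) ⟩
  sum (map (λ A → ∑[ i < suc t ] weightVia i A) L)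
    ≡⟨ sum-map-∑ (suc t) weightVia L ⟩
  ∑[ i < suc t ] sum (map (weightVia i) L)
    ≡⟨ sum-cong-≗ (λ i → sum-weight-link i L) ⟨
  ∑[ i < suc t ] sum (map (weight t) (link i L))
    ≤⟨ ∑-mono-≤ (λ i → lubell t (link i L) (link-antichain i anti)) ⟩
  ∑[ i < suc t ] (t !)
    ≡⟨ ∑-const (suc t) (t !) ⟩
  suc t ! ∎
  where open ≤-Reasoning

factorial-shift : ∀ {a b} → a ≤ b → suc a ! * b ! ≤ a ! * suc b !
factorial-shift {a} {b} a≤b = begin
  suc a ! * b !          ≡⟨ *-assoc (suc a) (a !) (b !) ⟩
  suc a * (a ! * b !)    ≤⟨ *-monoˡ-≤ (a ! * b !) (s≤s a≤b) ⟩
  suc b * (a ! * b !)    ≡⟨ x∙yz≈y∙xz (suc b) (a !) (b !) ⟩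
  a ! * suc b !          ∎
  where open ≤-Reasoning

factorial-transfer : ∀ j a b → a + j ≤ suc b → (a + j) ! * b ! ≤ a ! * (b + j) !
factorial-transfer zero    a b _ rewrite +-identityʳ a | +-identityʳ b = ≤-refl
factorial-transfer (suc j) a b a+j<b rewrite +-suc a j | +-suc b j =
  ≤-trans (factorial-shift a+j≤b) (factorial-transfer j a (suc b) (m≤n⇒m≤1+n (m≤n⇒m≤1+n a+j≤b)))
  where
  a+j≤b : a + j ≤ b
  a+j≤b = s≤s⁻¹ a+j<b

smaller-part-≤-floor : ∀ {a b c d} → b ≤ suc a → c ≤ d → a + b ≡ c + d → c ≤ a
smaller-part-≤-floor {a} {b} {c} {d} b≤1+a c≤d a+b≡c+d =
  ≮⇒≥ λ a<c → 1+n≰n (+-cancelʳ-≤ (suc a) (suc a) a (begin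
    suc a + suc a  ≤⟨ +-mono-≤ a<c (≤-trans a<c c≤d) ⟩
    c + d          ≡⟨ a+b≡c+d ⟨
    a + b          ≤⟨ +-monoʳ-≤ a b≤1+a ⟩
    a + suc a      ∎))
  where open ≤-Reasoning

balanced-factorials-minimal : ∀ {a b c d} → a ≤ b → b ≤ suc a → c ≤ d → a + b ≡ c + d →
                              a ! * b ! ≤ c ! * d !
balanced-factorials-minimal {a} {b} {c} {d} a≤b b≤1+a c≤d a+b≡c+d
  with m≤n⇒∃[o]m+o≡n (smaller-part-≤-floor b≤1+a c≤d a+b≡c+d)
... | j , refl = subst (λ e → (c + j) ! * b ! ≤ c ! * e !) (sym d≡b+j)
                       (factorial-transfer j c b (m≤n⇒m≤1+n a≤b))
  where
  d≡b+j : d ≡ b + j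
  d≡b+j = trans (+-cancelˡ-≡ c d (j + b) (trans (sym a+b≡c+d) (+-assoc c j b))) (+-comm j b)

half-balanced : ∀ t → t / 2 ≤ t ∸ t / 2 × t ∸ t / 2 ≤ suc (t / 2)
half-balanced t = subst (t / 2 ≤_) (sym rest) (m≤n+m (t / 2) (t % 2))
                , subst (_≤ suc (t / 2)) (sym rest) (+-monoˡ-≤ (t / 2) (s≤s⁻¹ (m%n<n t 2)))
  where
  rest : t ∸ t / 2 ≡ t % 2 + t / 2
  rest = begin
    t ∸ t / 2                          ≡⟨ cong (_∸ t / 2) (m≡m%n+[m/n]*n t 2) ⟩
    t % 2 + t / 2 * 2 ∸ t / 2          ≡⟨ cong (λ e → t % 2 + e ∸ t / 2) (*-comm (t / 2) 2) ⟩
    t % 2 + (t / 2 + (t / 2 + 0)) ∸ t / 2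
      ≡⟨ cong (λ e → t % 2 + (t / 2 + e) ∸ t / 2) (+-identityʳ (t / 2)) ⟩
    t % 2 + (t / 2 + t / 2) ∸ t / 2    ≡⟨ cong (_∸ t / 2) (+-assoc (t % 2) (t / 2) (t / 2)) ⟨
    t % 2 + t / 2 + t / 2 ∸ t / 2      ≡⟨ m+n∸n≡m (t % 2 + t / 2) (t / 2) ⟩
    t % 2 + t / 2                      ∎
    where open ≡-Reasoning

middleWeight : ℕ → ℕ
middleWeight t = (t / 2) ! * (t ∸ t / 2) !

middleWeight≢0 : ∀ t → NonZero (middleWeight t)
middleWeight≢0 t = (t / 2) !* (t ∸ t / 2) !≢0

middleWeight-minimal : ∀ {c d} → c + d ≡ t → middleWeight t ≤ c ! * d !
middleWeight-minimal {t} {c} {d} c+d≡t with half-balanced t | c ≤? d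
... | t/2≤rest , rest≤1+t/2 | yes c≤d =
  balanced-factorials-minimal t/2≤rest rest≤1+t/2 c≤d (trans (m+[n∸m]≡n (m/n≤m t 2)) (sym c+d≡t))
... | t/2≤rest , rest≤1+t/2 | no c≰d = subst (middleWeight t ≤_) (*-comm (d !) (c !))
  (balanced-factorials-minimal t/2≤rest rest≤1+t/2 (≰⇒≥ c≰d)
    (trans (m+[n∸m]≡n (m/n≤m t 2)) (sym (trans (+-comm d c) c+d≡t))))

middleWeight-≤-weight : ∀ (A : Subset t) → middleWeight t ≤ weight t A
middleWeight-≤-weight A = middleWeight-minimal {c = ∣ A ∣} (m+[n∸m]≡n (∣p∣≤n A))

centralBinom-*-middleWeight : ∀ t → centralBinom t * middleWeight t ≡ t !
centralBinom-*-middleWeight t =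
  trans (cong (_* middleWeight t) (nCk≡n!/k![n-k]! t/2≤t))
        (m/n*n≡m {{middleWeight≢0 t}} (k![n∸k]!∣n! t/2≤t))
  where
  t/2≤t : t / 2 ≤ t
  t/2≤t = m/n≤m t 2

length-*-≤-sum-map : ∀ {A : Set} {c} (f : A → ℕ) → (∀ x → c ≤ f x) →
                     ∀ xs → length xs * c ≤ sum (map f xs)
length-*-≤-sum-map f c≤f []       = z≤n
length-*-≤-sum-map f c≤f (x ∷ xs) = +-mono-≤ (c≤f x) (length-*-≤-sum-map f c≤f xs)

tabulate-antichain : ∀ {m} {A : Fin m → Subset t} → (∀ i j → i ≢ j → A i ⊈ A j) →
                     AllPairs Incomparable (tabulate A)
tabulate-antichain anti = AllPairsₚ.tabulate⁺ (λ i≢j → anti _ _ i≢j , anti _ _ (i≢j ∘ sym))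

sperner : ∀ {m t} → HasAntichain m t → m ≤ centralBinom t
sperner {m} {t} (A , anti) = *-cancelʳ-≤ m (centralBinom t) (middleWeight t) {{middleWeight≢0 t}} (begin
  m * middleWeight t                    ≡⟨ cong (_* middleWeight t) (length-tabulate A) ⟨
  length (tabulate A) * middleWeight t  ≤⟨ length-*-≤-sum-map (weight t) middleWeight-≤-weight (tabulate A) ⟩
  sum (map (weight t) (tabulate A))     ≤⟨ lubell t (tabulate A) (tabulate-antichain anti) ⟩
  t !                                   ≡⟨ centralBinom-*-middleWeight t ⟨
  centralBinom t * middleWeight t       ∎)
  where open ≤-Reasoning

-- Antichains of equal-size subsets

AllPairs-lookup : ∀ {A : Set} {R : A → A → Set} → (∀ {x y} → R x y → R y x) →
                  ∀ {xs} → AllPairs R xs → ∀ {i j} → i ≢ j → R (lookup xs i) (lookup xs j)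
AllPairs-lookup R-sym (_   ∷ _)     {zero}  {zero}  i≢j = contradiction refl i≢j
AllPairs-lookup R-sym (Rxs ∷ _)     {zero}  {suc j} _   = All.lookup Rxs (∈-lookup j)
AllPairs-lookup R-sym (Rxs ∷ _)     {suc i} {zero}  _   = R-sym (All.lookup Rxs (∈-lookup i))
AllPairs-lookup R-sym (_   ∷ pairs) {suc i} {suc j} i≢j = AllPairs-lookup R-sym pairs (i≢j ∘ cong suc)

antichain⇒HasAntichain : ∀ {m} (L : List (Subset t)) → AllPairs Incomparable L → m ≤ length L →
                         HasAntichain m t
antichain⇒HasAntichain L anti m≤∣L∣ =
  (λ i → lookup L (inject≤ i m≤∣L∣)) ,
  λ i j i≢j → proj₁ (AllPairs-lookup swap anti (i≢j ∘ inject≤-injective m≤∣L∣ m≤∣L∣ i j))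

∷-incomparable : ∀ {s} {A B : Subset t} → Incomparable A B → Incomparable (s ∷ A) (s ∷ B)
∷-incomparable (A⊈B , B⊈A) = A⊈B ∘ drop-∷-⊆ , B⊈A ∘ drop-∷-⊆

inside-outside-incomparable : ∀ {A B : Subset t} → ∣ A ∣ < ∣ B ∣ → Incomparable (inside ∷ A) (outside ∷ B)
inside-outside-incomparable ∣A∣<∣B∣ = (λ A⊆B → contradiction (A⊆B here) λ ())
                                    , (λ B⊆A → <⇒≱ ∣A∣<∣B∣ (p⊆q⇒∣p∣≤∣q∣ (drop-∷-⊆ B⊆A)))

layer : ∀ t → ℕ → List (Subset t)
layer t       zero    = [ ⊥ ]
layer zero    (suc k) = []
layer (suc t) (suc k) = map (inside ∷_) (layer t k) ++ map (outside ∷_) (layer t (suc k))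

length-layer : ∀ t k → length (layer t k) ≡ t C k
length-layer t       zero    = refl
length-layer zero    (suc k) = refl
length-layer (suc t) (suc k) = begin
  length (map (inside ∷_) (layer t k) ++ map (outside ∷_) (layer t (suc k)))
    ≡⟨ length-++ (map (inside ∷_) (layer t k)) ⟩
  length (map (inside ∷_) (layer t k)) + length (map (outside ∷_) (layer t (suc k)))
    ≡⟨ cong₂ _+_ (length-map _ (layer t k)) (length-map _ (layer t (suc k))) ⟩
  length (layer t k) + length (layer t (suc k))
    ≡⟨ cong₂ _+_ (length-layer t k) (length-layer t (suc k)) ⟩
  t C k + t C suc k
    ≡⟨ nCk+nC[k+1]≡[n+1]C[k+1] t k ⟩
  suc t C suc k ∎
  where open ≡-Reasoning

layer-size : ∀ t k → All (λ A → ∣ A ∣ ≡ k) (layer t k)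
layer-size t       zero    = ∣⊥∣≡0 t ∷ []
layer-size zero    (suc k) = []
layer-size (suc t) (suc k) = Allₚ.++⁺ (Allₚ.map⁺ (All.map (cong suc) (layer-size t k)))
                                     (Allₚ.map⁺ (layer-size t (suc k)))

layer-antichain : ∀ t k → AllPairs Incomparable (layer t k)
layer-antichain t       zero    = [] ∷ []
layer-antichain zero    (suc k) = []
layer-antichain (suc t) (suc k) = AllPairsₚ.++⁺
  (AllPairsₚ.map⁺ (AllPairs.map ∷-incomparable (layer-antichain t k)))
  (AllPairsₚ.map⁺ (AllPairs.map ∷-incomparable (layer-antichain t (suc k))))
  (Allₚ.map⁺ (All.map (λ ∣A∣≡k → Allₚ.map⁺ (All.map (λ ∣B∣≡1+k →
     inside-outside-incomparable (subst₂ _<_ (sym ∣A∣≡k) (sym ∣B∣≡1+k) ≤-refl))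
       (layer-size t (suc k)))) (layer-size t k)))

centralBinom-antichain : ∀ {m t} → m ≤ centralBinom t → HasAntichain m t
centralBinom-antichain {t = t} m≤ =
  antichain⇒HasAntichain (layer t (t / 2)) (layer-antichain t (t / 2))
                         (subst (_ ≤_) (sym (length-layer t (t / 2))) m≤)

HasAntichain-suc : ∀ {m} → HasAntichain m t → HasAntichain m (suc t)
HasAntichain-suc (A , anti) = (λ i → outside ∷ A i) , λ i j i≢j → anti i j i≢j ∘ drop-∷-⊆

centralBinom-≤-suc : ∀ t → centralBinom t ≤ centralBinom (suc t)
centralBinom-≤-suc t = sperner (HasAntichain-suc (centralBinom-antichain {t = t} ≤-refl))

centralBinom-mono-≤ : ∀ {x y} → x ≤ y → centralBinom x ≤ centralBinom y
centralBinom-mono-≤ = mono ∘ ≤⇒≤′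
  where
  mono : ∀ {x y} → x ≤′ y → centralBinom x ≤ centralBinom y
  mono (≤′-reflexive refl)       = ≤-refl
  mono {y = suc y} (≤′-step x≤′y) = ≤-trans (mono x≤′y) (centralBinom-≤-suc y)

centralBinom-cancel-< : ∀ {x y} → centralBinom x < centralBinom y → x < y
centralBinom-cancel-< {x} {y} Cx<Cy = ≰⇒> (<⇒≱ Cx<Cy ∘ centralBinom-mono-≤ {y} {x})

-- Halving an antichain along its first point

slice : Side → List (Subset (suc t)) → List (Subset t)
slice s []            = []
slice s ((x ∷ A) ∷ L) with x Bool.≟ s
... | yes _ = A ∷ slice s L
... | no  _ = slice s L

length-slices : ∀ (L : List (Subset (suc t))) → length (slice inside L) + length (slice outside L) ≡ length L
length-slices []                  = refl
length-slices ((inside  ∷ _) ∷ L) = cong suc (length-slices L)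
length-slices ((outside ∷ _) ∷ L) = trans (+-suc _ _) (cong suc (length-slices L))

slice-All : ∀ {s} {A : Subset t} {L} → All (Incomparable (s ∷ A)) L → All (Incomparable A) (slice s L)
slice-All         []                         = []
slice-All {s = s} {L = (x ∷ _) ∷ _} (sA∥xB ∷ sA∥L) with x Bool.≟ s
... | yes refl = (proj₁ sA∥xB ∘ s⊆s , proj₂ sA∥xB ∘ s⊆s) ∷ slice-All sA∥L
... | no  _    = slice-All sA∥L

slice-antichain : ∀ s {L : List (Subset (suc t))} → AllPairs Incomparable L → AllPairs Incomparable (slice s L)
slice-antichain s []                              = []
slice-antichain s {(x ∷ _) ∷ _} (xA∥L ∷ anti) with x Bool.≟ s
... | yes refl = slice-All xA∥L ∷ slice-antichain s anti
... | no  _    = slice-antichain s anti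

antichain-halve : ∀ {n} (L : List (Subset (suc t))) → AllPairs Incomparable L → n + n ≤ length L →
                  HasAntichain n t
antichain-halve {n = n} L anti n+n≤∣L∣ with n ≤? length (slice inside L)
... | yes n≤∣in∣ = antichain⇒HasAntichain (slice inside L) (slice-antichain inside anti) n≤∣in∣
... | no  n≰∣in∣ = antichain⇒HasAntichain (slice outside L) (slice-antichain outside anti)
  (+-cancelˡ-≤ n n _ (begin
    n + n                                               ≤⟨ n+n≤∣L∣ ⟩
    length L                                            ≡⟨ length-slices L ⟨
    length (slice inside L) + length (slice outside L)  ≤⟨ +-monoˡ-≤ _ (<⇒≤ (≰⇒> n≰∣in∣)) ⟩
    n + length (slice outside L)                        ∎))
  where open ≤-Reasoning

HasAntichain-halve : ∀ {n} → HasAntichain (n + n) (suc t) → HasAntichain n t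
HasAntichain-halve (A , anti) =
  antichain-halve (tabulate A) (tabulate-antichain anti) (≤-reflexive (sym (length-tabulate A)))

minimum-antichain-double : ∀ {n t₀} → 1 ≤ n → IsMinimum (HasAntichain n) t₀ → HasAntichain (n + n) t →
                           t₀ < t
minimum-antichain-double {t = zero}  1≤n _              anti =
  contradiction (sperner anti) (<⇒≱ (+-mono-≤ 1≤n 1≤n))
minimum-antichain-double {t = suc t} _   (_ , t₀-least) anti = s≤s (t₀-least t (HasAntichain-halve anti))

-- Cover-free families for the friendship graph

++-⊆⁻ : ∀ {m} {X Y : Subset m} {Z W : Subset t} → X ++ᵛ Z ⊆ Y ++ᵛ W → X ⊆ Y × Z ⊆ W
++-⊆⁻ {X = []}    {[]}    XZ⊆YW = (λ ()) , XZ⊆YW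
++-⊆⁻ {X = _ ∷ _} {_ ∷ _} XZ⊆YW with ++-⊆⁻ (drop-∷-⊆ XZ⊆YW)
... | X⊆Y , Z⊆W = ∷-⊆ (⊆-head XZ⊆YW) X⊆Y , Z⊆W

⊈-++ˡ : ∀ {m} {X Y : Subset m} {Z W : Subset t} → X ⊈ Y → X ++ᵛ Z ⊈ Y ++ᵛ W
⊈-++ˡ X⊈Y = X⊈Y ∘ proj₁ ∘ ++-⊆⁻

⊈-++ʳ : ∀ {m} {X Y : Subset m} {Z W : Subset t} → Z ⊈ W → X ++ᵛ Z ⊈ Y ++ᵛ W
⊈-++ʳ Z⊈W = Z⊈W ∘ proj₂ ∘ ++-⊆⁻

++-∪ : ∀ {m} (X Y : Subset m) (Z W : Subset t) → (X ++ᵛ Z) ∪ (Y ++ᵛ W) ≡ (X ∪ Y) ++ᵛ (Z ∪ W)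
++-∪ X Y Z W = zipWith-++ Bool._∨_ X Z Y W

⁅⁆⊈⁅⁆ : ∀ {x y : Fin t} → x ≢ y → ⁅ x ⁆ ⊈ ⁅ y ⁆
⁅⁆⊈⁅⁆ {x = x} {y} x≢y x⊆y = x≢y (x∈⁅y⁆⇒x≡y y (x⊆y (x∈⁅x⁆ x)))

⁅⁆⊈⁅⁆∪⁅⁆ : ∀ {x y z : Fin t} → x ≢ y → x ≢ z → ⁅ x ⁆ ⊈ ⁅ y ⁆ ∪ ⁅ z ⁆
⁅⁆⊈⁅⁆∪⁅⁆ {x = x} {y} {z} x≢y x≢z x⊆y∪z =
  [ x≢y ∘ x∈⁅y⁆⇒x≡y y , x≢z ∘ x∈⁅y⁆⇒x≡y z ]′ (x∈p∪q⁻ ⁅ y ⁆ ⁅ z ⁆ (x⊆y∪z (x∈⁅x⁆ x)))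

-- The singleton tags separate both ends of an edge from each other and from every
-- vertex tagged differently from both; the remaining vertices are left to the labels.
module _ (G : Graph) {t k} (label : V G → Subset t) (tag : V G → Fin k) where

  tagged-GCFF : (∀ {a b} → Adj G a b → tag a ≢ tag b) →
                (∀ {a b} w → Adj G a b → w ≢ a → w ≢ b →
                   (tag w ≢ tag a × tag w ≢ tag b) ⊎ label w ⊈ label a ∪ label b) →
                IsGCFF G (t + k) (λ v → label v ++ᵛ ⁅ tag v ⁆)
  tagged-GCFF tags-differ separated a b a~b =
    ⊈-++ʳ (⁅⁆⊈⁅⁆ (tags-differ a~b)) ,
    ⊈-++ʳ (⁅⁆⊈⁅⁆ (tags-differ a~b ∘ sym)) ,
    λ w w≢a w≢b →
      subst (label w ++ᵛ ⁅ tag w ⁆ ⊈_) (sym (++-∪ (label a) (label b) ⁅ tag a ⁆ ⁅ tag b ⁆))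
      ([ ⊈-++ʳ ∘ uncurry ⁅⁆⊈⁅⁆∪⁅⁆ , ⊈-++ˡ ]′ (separated w a~b w≢a w≢b))

pattern centre   = inj₁ tt
pattern leaf i b = inj₂ (i , b)

leafTag : Bool → Fin 3
leafTag false = suc zero
leafTag true  = suc (suc zero)

leafTag-injective : ∀ {b c} → leafTag b ≡ leafTag c → b ≡ c
leafTag-injective {false} {false} _ = refl
leafTag-injective {true}  {true}  _ = refl

leafTag≢zero : ∀ b → leafTag b ≢ zero
leafTag≢zero false ()
leafTag≢zero true  ()

friendshipTag : ∀ {n} → FVert n → Fin 3
friendshipTag centre     = zero
friendshipTag (leaf _ b) = leafTag b

friendshipLabel : ∀ {n} → (Fin n → Subset t) → FVert n → Subset t
friendshipLabel A centre     = ⊥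
friendshipLabel A (leaf i _) = A i

friendship-tags-differ : ∀ {n} {a b : FVert n} → FAdj n a b → friendshipTag a ≢ friendshipTag b
friendship-tags-differ {a = centre}   {leaf _ b} _         = leafTag≢zero b ∘ sym
friendship-tags-differ {a = leaf _ b} {centre}   _         = leafTag≢zero b
friendship-tags-differ {a = leaf _ b} {leaf _ c} (_ , b≢c) = b≢c ∘ leafTag-injective

module _ {n} {A : Fin n → Subset t} (anti : ∀ i j → i ≢ j → A i ⊈ A j) where

  private
    tag   = friendshipTag {n}
    label = friendshipLabel A

  centre-leaf-separated : ∀ {i b} w → w ≢ centre → w ≢ leaf i b →
                          (tag w ≢ tag centre × tag w ≢ tag (leaf i b)) ⊎
                          label w ⊈ label centre ∪ label (leaf i b)
  centre-leaf-separated         centre     w≢a _ = contradiction refl w≢a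
  centre-leaf-separated {i} {b} (leaf j c) _   w≢b with c Bool.≟ b
  ... | yes refl =
    inj₂ (subst (A j ⊈_) (sym (∪-identityˡ (A i))) (anti j i (w≢b ∘ cong (λ j → leaf j c))))
  ... | no  c≢b  = inj₁ (leafTag≢zero c , c≢b ∘ leafTag-injective)

  friendship-separated : ∀ {a b} w → FAdj n a b → w ≢ a → w ≢ b →
                         (tag w ≢ tag a × tag w ≢ tag b) ⊎ label w ⊈ label a ∪ label b
  friendship-separated {centre}   {leaf _ _} w _ w≢a w≢b = centre-leaf-separated w w≢a w≢b
  friendship-separated {leaf i _} {centre}   w _ w≢a w≢b =
    Sum.map swap (subst (label w ⊈_) (∪-comm ⊥ (A i))) (centre-leaf-separated w w≢b w≢a)
  friendship-separated {leaf _ b} {leaf _ c} centre (refl , _) _ _ =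
    inj₁ (leafTag≢zero b ∘ sym , leafTag≢zero c ∘ sym)
  friendship-separated {leaf i b} {leaf i c} (leaf j d) (refl , b≢c) w≢a w≢b with j Fin.≟ i | d Bool.≟ b
  ... | no  j≢i  | _        = inj₂ (subst (A j ⊈_) (sym (∪-idem (A i))) (anti j i j≢i))
  ... | yes refl | yes refl = contradiction refl w≢a
  ... | yes refl | no  d≢b  =
    contradiction (cong (leaf i) (trans (¬-not d≢b) (sym (¬-not (b≢c ∘ sym))))) w≢b

friendship-upper : ∀ {n t} → HasAntichain n t → HasGCFF (friendship n) (t + 3)
friendship-upper {n} (A , anti) =
  _ , tagged-GCFF (friendship n) (friendshipLabel A) friendshipTag
                  friendship-tags-differ (friendship-separated anti)

leafIndex : ∀ {n} → Fin n ⊎ Fin n → Fin n × Bool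
leafIndex (inj₁ i) = i , false
leafIndex (inj₂ i) = i , true

leafIndex-injective : ∀ {n} {u v : Fin n ⊎ Fin n} → leafIndex u ≡ leafIndex v → u ≡ v
leafIndex-injective {u = inj₁ _} {inj₁ _} refl = refl
leafIndex-injective {u = inj₂ _} {inj₂ _} refl = refl

leafAt : ∀ n → Fin (n + n) → FVert n
leafAt n k = inj₂ (leafIndex (Fin.splitAt n k))

leafAt-injective : ∀ n {k l} → leafAt n k ≡ leafAt n l → k ≡ l
leafAt-injective n {k} {l} eq = begin
  k                                ≡⟨ join-splitAt n n k ⟨
  Fin.join n n (Fin.splitAt n k)   ≡⟨ cong (Fin.join n n) (leafIndex-injective (inj₂-injective eq)) ⟩
  Fin.join n n (Fin.splitAt n l)   ≡⟨ join-splitAt n n l ⟩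
  l                                ∎
  where open ≡-Reasoning

friendship-lower : ∀ {n t} → 1 ≤ n → HasGCFF (friendship n) t → HasAntichain (n + n) (pred t)
friendship-lower {n} 1≤n (B , cff) with nonempty? (B centre)
... | no centre-empty = ⊥-elim (proj₁ (cff centre (leaf first false) tt) (Empty⇒⊆ centre-empty))
  where
  first : Fin n
  first = Fin.fromℕ< 1≤n
friendship-lower {n} {suc t} _ (B , cff) | yes (x , x∈Bc) =
  (λ k → removeAt (B (leafAt n k)) x) ,
  λ k l k≢l Bk⊆Bl →
    proj₂ (proj₂ (cff centre (leafAt n l) tt)) (leafAt n k) (λ ()) (k≢l ∘ leafAt-injective n)
      (removeAt-⊆⁻ x (x∈p∪q⁺ (inj₁ x∈Bc)) (⊆-trans Bk⊆Bl (removeAt-⊆ x (q⊆p∪q (B centre) _))))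

n+n≤m⇒n≤m/2 : ∀ {m n} → n + n ≤ m → n ≤ m / 2
n+n≤m⇒n≤m/2 {m} {n} n+n≤m =
  subst (_≤ m / 2) (m*n/n≡m n 2) (/-monoˡ-≤ 2 (subst (_≤ m) n+n≡n*2 n+n≤m))
  where
  n+n≡n*2 : n + n ≡ n * 2
  n+n≡n*2 = trans (cong (n +_) (sym (+-identityʳ n))) (*-comm 2 n)

centralBinom-suc-≤-barbar : ∀ {n m m′ t₀} → IsMinimum (HasAntichain n) t₀ →
                            BarSet n m → BarSet (m + 1) m′ → centralBinom (suc t₀) ≤ m′
centralBinom-suc-≤-barbar {t₀ = t₀} (_ , t₀-least) (x , refl , n≤Cx) (y , refl , Cx+1≤Cy) =
  centralBinom-mono-≤ (centralBinom-cancel-< {t₀} {y} (begin-strict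
    centralBinom t₀      ≤⟨ centralBinom-mono-≤ (t₀-least x (centralBinom-antichain n≤Cx)) ⟩
    centralBinom x       <⟨ subst (_≤ centralBinom y) (+-comm (centralBinom x) 1) Cx+1≤Cy ⟩
    centralBinom y       ∎))
  where open ≤-Reasoning

corollary7p5 : ∀ (n : ℕ) → 2 ≤ n →
    ∀ (nbar nbar1bar t1n tF : ℕ) →
    IsMinimum (BarSet n) nbar →
    IsMinimum (BarSet (nbar + 1)) nbar1bar →
    IsMinimum (HasAntichain n) t1n →
    IsMinimum (HasGCFF (friendship n)) tF →
    ((nbar1bar / 2 < n → tF ≡ t1n + 3) ×
     (¬ (nbar1bar / 2 < n) → (t1n + 2 ≤ tF) × (tF ≤ t1n + 3)))
corollary7p5 n 2≤n _ nbar1bar t1n tF (nbar∈ , _) (nbar1bar∈ , _) t1n-min (tF-ok , tF-least) =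
  (λ half<n → ≤-antisym upper (≮⇒≥ (<⇒≱ half<n ∘ n+n≤m⇒n≤m/2 ∘ short⇒n+n≤nbar1bar))) ,
  λ _ → lower , upper
  where
  1≤n : 1 ≤ n
  1≤n = ≤-trans (s≤s z≤n) 2≤n

  leaf-antichain : HasAntichain (n + n) (pred tF)
  leaf-antichain = friendship-lower 1≤n tF-ok

  upper : tF ≤ t1n + 3
  upper = tF-least (t1n + 3) (friendship-upper (proj₁ t1n-min))

  lower : t1n + 2 ≤ tF
  lower = subst (_≤ tF) (+-comm 2 t1n)
                (pred-cancel-< (minimum-antichain-double 1≤n t1n-min leaf-antichain))

  short⇒n+n≤nbar1bar : tF < t1n + 3 → n + n ≤ nbar1bar
  short⇒n+n≤nbar1bar tF<t1n+3 = begin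
    n + n                   ≤⟨ sperner leaf-antichain ⟩
    centralBinom (pred tF)  ≤⟨ centralBinom-mono-≤ (pred-mono-≤ tF≤2+t1n) ⟩
    centralBinom (suc t1n)  ≤⟨ centralBinom-suc-≤-barbar t1n-min nbar∈ nbar1bar∈ ⟩
    nbar1bar                ∎
    where
    open ≤-Reasoning
    tF≤2+t1n : tF ≤ 2 + t1n
    tF≤2+t1n = s≤s⁻¹ (subst (suc tF ≤_) (+-comm t1n 3) tF<t1n+3)
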